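{- For any epistemic theory $\Gamma$, every equilibrium world view of $\Gamma$ is also a G91-world view of $\Gamma$.
   Context: Fix a set $\mathrm{At}$ of atoms. Formulas: $\varphi ::= \bot \mid a \mid \varphi_1\wedge\varphi_2 \mid \varphi_1\vee\varphi_2\mid \varphi_1\to\varphi_2 \mid \mathbf{L}\varphi$; $\neg\varphi := \varphi\to\bot$, $\top:=\neg\bot$. A theory is a set of formulas. G91. A belief view $\mathcal W$ is a set of interpretations $I\subseteq\mathrm{At}$. $\langle\mathcal W,I\rangle\models\varphi$ is classical on $\bot,\wedge,\vee,\to$, with $\langle\mathcal W,I\rangle\models a$ iff $a\in I$ and $\langle\mathcal W,I\rangle\models\mathbf L\psi$ iff $\langle\mathcal W,J\rangle\models\psi$ for all $J\in\mathcal W$ (write $\mathcal W\models\mathbf L\psi$). The subjective reduct $\Gamma^{\mathcal W}$ replaces each maximal subformula $\mathbf L\psi$ by $\top$ if $\mathcal W\models\mathbf L\psi$, else by $\bot$. For $\mathbf L$-free formulas, HT satisfaction on pairs $\langle H,T\rangle$, $H\subseteq T$: $\not\models\bot$; $\models p$ iff $p\in H$; $\wedge,\vee$ componentwise; $\models\varphi\to\psi$ iff $T\models\varphi\to\psi$ classically and ($\not\models\varphi$ or $\models\psi$). $T$ is a stable model of $\Gamma$ iff $T\models\Gamma$ classically and no $H\subsetneq T$ has $\langle H,T\rangle\models\Gamma$; $\mathrm{SM}[\Gamma]$ is the set of stable models. $\mathcal W$ is a G91-world view of $\Gamma$ iff $\mathcal W=\mathrm{SM}[\Gamma^{\mathcal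 W}]$. FAEEL. HT belief views are non-empty sets $\mathcal W$ of pairs $\langle H_i,T_i\rangle$, $H_i\subseteq T_i\subseteq\mathrm{At}$; $\mathcal W^t=\{T_i\}$; total if all $H_i=T_i$ (identified with a set of interpretations). For $\mathcal I=\langle\mathcal W,H,T\rangle$ with $H\subseteq T$: $\mathcal I\not\models\bot$; $\mathcal I\models a$ iff $a\in H$; $\wedge,\vee$ componentwise; $\mathcal I\models\psi_1\to\psi_2$ iff ($\mathcal I\not\models\psi_1$ or $\mathcal I\models\psi_2$) and ($\langle\mathcal W^t,T,T\rangle\not\models\psi_1$ or $\langle\mathcal W^t,T,T\rangle\models\psi_2$); $\mathcal I\models\mathbf L\psi$ iff $\langle\mathcal W,H_i,T_i\rangle\models\psi$ for all $\langle H_i,T_i\rangle\in\mathcal W$. Belief model of $\Gamma$: $\langle\mathcal W,H_i,T_i\rangle\models\varphi$ for all $\varphi\in\Gamma$ and all $\langle H_i,T_i\rangle\in\mathcal W\cup\{\langle H,T\rangle\}$. $\langle\mathcal W',H',T'\rangle\preceq\langle\mathcal W,H,T\rangle$ iff $T'=T$, $H'\subseteq H$, every $\langle H_i,T_i\rangle\in\mathcal W$ has some $\langle H'_i,T_i\rangle\in\mathcal W'$ with $H'_i\subseteq H_i$, and every $\langle H'_i,T_i\rangle\in\mathcal W'$ has some $\langle H_i,T_i\rangle\in\mathcal W$ with $H'_i\subseteq H_i$; $\prec$ strict. A total $\langle\mathcal W,T,T\rangle$ is an equilibrium belief model of $\Gamma$ if it is a belief model and no belief model is $\prec$ it; $\mathrm{EQB}[\Gamma]$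 their set. A total belief view $\mathcal W$ is an equilibrium world view of $\Gamma$ iff $\mathcal W=\{T:\langle\mathcal W,T,T\rangle\in\mathrm{EQB}[\Gamma]\}$. -}

module Defs where

open import Level using (0ℓ)
open import Data.Bool using (Bool; true)
open import Data.Empty using (⊥)
open import Data.Product using (Σ; ∃; _×_; _,_)
open import Data.Sum using (_⊎_)
open import Relation.Nullary using (¬_)
open import Relation.Binary.PropositionalEquality using (_≡_; _≢_)

data Form (At : Set) : Set where
  ⊥'   : Form At
  atom : At → Form At
  _∧'_ : Form At → Form At → Form At
  _∨'_ : Form At → Form At → Form At
  _⇒_  : Form At → Form At → Form At
  L    : Form At → Form At

¬' : {At : Set} → Form At → Form At
¬' φ = φ ⇒ ⊥'

⊤' : {At : Set} → Form At
⊤' = ¬' ⊥'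

data PForm (At : Set) : Set where
  ⊥p    : PForm At
  atomp : At → PForm At
  _∧p_  : PForm At → PForm At → PForm At
  _∨p_  : PForm At → PForm At → PForm At
  _⇒p_  : PForm At → PForm At → PForm At

⊤p : {At : Set} → PForm At
⊤p = ⊥p ⇒p ⊥p

Theory : Set → Set₁
Theory At = Form At → Set

Interp : Set → Set
Interp At = At → Bool

_⊆I_ : {At : Set} → Interp At → Interp At → Set
H ⊆I T = ∀ a → H a ≡ true → T a ≡ true

_⊂I_ : {At : Set} → Interp At → Interp At → Set
H ⊂I T = H ⊆I T × H ≢ T

View : Set → Set₁
View At = Interp At → Set

mutual
  gsat : {At : Set} → View At → Interp At → Form At → Set
  gsat W I ⊥'        = ⊥
  gsat W I (atom a)  = I a ≡ true
  gsat W I (φ ∧' ψ)  = gsat W I φ × gsat W I ψ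
  gsat W I (φ ∨' ψ)  = gsat W I φ ⊎ gsat W I ψ
  gsat W I (φ ⇒ ψ)   = gsat W I φ → gsat W I ψ
  gsat W I (L ψ)     = ModelsL W ψ

  ModelsL : {At : Set} → View At → Form At → Set
  ModelsL W ψ = ∀ J → W J → gsat W J ψ

data Red {At : Set} (W : View At) : Form At → PForm At → Set where
  r⊥   : Red W ⊥' ⊥p
  ratm : ∀ a → Red W (atom a) (atomp a)
  r∧   : ∀ {φ ψ φ' ψ'} → Red W φ φ' → Red W ψ ψ' → Red W (φ ∧' ψ) (φ' ∧p ψ')
  r∨   : ∀ {φ ψ φ' ψ'} → Red W φ φ' → Red W ψ ψ' → Red W (φ ∨' ψ) (φ' ∨p ψ')
  r⇒   : ∀ {φ ψ φ' ψ'} → Red W φ φ' → Red W ψ ψ' → Red W (φ ⇒ ψ) (φ' ⇒p ψ')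
  rL⊤  : ∀ {ψ} → ModelsL W ψ → Red W (L ψ) ⊤p
  rL⊥  : ∀ {ψ} → ¬ ModelsL W ψ → Red W (L ψ) ⊥p

reduct : {At : Set} → Theory At → View At → PForm At → Set
reduct Γ W φ' = ∃ λ φ → Γ φ × Red W φ φ'

csat : {At : Set} → Interp At → PForm At → Set
csat T ⊥p        = ⊥
csat T (atomp a) = T a ≡ true
csat T (φ ∧p ψ)  = csat T φ × csat T ψ
csat T (φ ∨p ψ)  = csat T φ ⊎ csat T ψ
csat T (φ ⇒p ψ)  = csat T φ → csat T ψ

htsat : {At : Set} → Interp At → Interp At → PForm At → Set
htsat H T ⊥p        = ⊥
htsat H T (atomp a) = H a ≡ true
htsat H T (φ ∧p ψ)  = htsat H T φ × htsat H T ψ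
htsat H T (φ ∨p ψ)  = htsat H T φ ⊎ htsat H T ψ
htsat H T (φ ⇒p ψ)  = csat T (φ ⇒p ψ) × (htsat H T φ → htsat H T ψ)

SM : {At : Set} → (PForm At → Set) → Interp At → Set
SM Δ T = (∀ φ → Δ φ → csat T φ)
       × (∀ H → H ⊂I T → ¬ (∀ φ → Δ φ → htsat H T φ))

G91WorldView : {At : Set} → Theory At → View At → Set
G91WorldView Γ W = ∀ I → (W I → SM (reduct Γ W) I) × (SM (reduct Γ W) I → W I)

HTView : Set → Set₁
HTView At = Interp At × Interp At → Set

IsHTView : {At : Set} → HTView At → Set
IsHTView 𝒲 = (∃ λ p → 𝒲 p) × (∀ H T → 𝒲 (H , T) → H ⊆I T)

totalView : {At : Set} → View At → HTView At
totalView W (H , T) = H ≡ T × W T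

tot : {At : Set} → HTView At → HTView At
tot 𝒲 = totalView (λ T → ∃ λ H → 𝒲 (H , T))

fsat : {At : Set} → HTView At → Interp At → Interp At → Form At → Set
fsat 𝒲 H T ⊥'       = ⊥
fsat 𝒲 H T (atom a) = H a ≡ true
fsat 𝒲 H T (φ ∧' ψ) = fsat 𝒲 H T φ × fsat 𝒲 H T ψ
fsat 𝒲 H T (φ ∨' ψ) = fsat 𝒲 H T φ ⊎ fsat 𝒲 H T ψ
fsat 𝒲 H T (φ ⇒ ψ)  = (fsat 𝒲 H T φ → fsat 𝒲 H T ψ)
                    × (fsat (tot 𝒲) T T φ → fsat (tot 𝒲) T T ψ)
fsat 𝒲 H T (L ψ)    = ∀ Hi Ti → 𝒲 (Hi , Ti) → fsat 𝒲 Hi Ti ψ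

BeliefModel : {At : Set} → Theory At → HTView At → Interp At → Interp At → Set
BeliefModel Γ 𝒲 H T =
  IsHTView 𝒲 × H ⊆I T ×
  (∀ φ → Γ φ → fsat 𝒲 H T φ × (∀ Hi Ti → 𝒲 (Hi , Ti) → fsat 𝒲 Hi Ti φ))

Preceq : {At : Set} → HTView At → Interp At → Interp At
       → HTView At → Interp At → Interp At → Set
Preceq 𝒲' H' T' 𝒲 H T =
  T' ≡ T × H' ⊆I H
  × (∀ Hi Ti → 𝒲 (Hi , Ti) → ∃ λ H'i → 𝒲' (H'i , Ti) × H'i ⊆I Hi)
  × (∀ H'i Ti → 𝒲' (H'i , Ti) → ∃ λ Hi → 𝒲 (Hi , Ti) × H'i ⊆I Hi)

_≐_ : {At : Set} → HTView At → HTView At → Set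
𝒲 ≐ 𝒲' = ∀ p → (𝒲 p → 𝒲' p) × (𝒲' p → 𝒲 p)

Prec : {At : Set} → HTView At → Interp At → Interp At
     → HTView At → Interp At → Interp At → Set
Prec 𝒲' H' T' 𝒲 H T =
  Preceq 𝒲' H' T' 𝒲 H T × ¬ (𝒲' ≐ 𝒲 × H' ≡ H × T' ≡ T)

EQB : {At : Set} → Theory At → View At → Interp At → Set₁
EQB Γ W T =
  BeliefModel Γ (totalView W) T T
  × (∀ 𝒲' H' T' → BeliefModel Γ 𝒲' H' T' → ¬ Prec 𝒲' H' T' (totalView W) T T)

-- W is an equilibrium world view of Γ (W a total, hence non-empty, belief view)
EqWorldView : {At : Set} → Theory At → View At → Set₁
EqWorldView Γ W = (∃ λ T → W T) × (∀ T → (W T → EQB Γ W T) × (EQB Γ W T → W T))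

-- For a total view W, FAEEL satisfaction ⟨W,H,T⟩ ⊨ φ coincides with HT
-- satisfaction of the subjective reduct of φ at ⟨H,T⟩: on a total view, L ψ
-- only inspects the members ⟨J,J⟩, where FAEEL and G91 satisfaction agree.
-- So, with the view kept fixed, belief models ⟨W,H,T⟩ are the HT models of
-- Γ^W, and ≺-minimality of ⟨W,T,T⟩ among them is stability of T for Γ^W.
-- Smaller belief models that change the view need not be considered: a view
-- 𝒲' strictly below W would, at any member T₀ of W, already give a belief
-- model ⟨𝒲',H₀,T₀⟩ ≺ ⟨W,T₀,T₀⟩, refuting equilibrium there.
module Submission where

open import Defs
open import Level using (Level; 0ℓ)
open import Axiom.ExcludedMiddle using (ExcludedMiddle)
open import Axiom.Extensionality.Propositional using (Extensionality)
open import Data.Product using (∃; _×_; _,_; proj₁; proj₂)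
open import Data.Product.Function.NonDependent.Propositional using (_×-⇔_)
open import Data.Sum.Function.Propositional using (_⊎-⇔_)
open import Function.Bundles using (_⇔_; mk⇔; Equivalence)
open import Function.Construct.Composition using (_⇔-∘_)
open import Function.Construct.Identity using (⇔-id)
open import Function.Related.TypeIsomorphisms using (→-cong-⇔)
open import Relation.Nullary using (¬_; yes; no)
open import Relation.Binary.PropositionalEquality using (refl)

open Equivalence using (to; from)

module _ {At : Set} where

  ⊆I-refl : {T : Interp At} → T ⊆I T
  ⊆I-refl _ Ta = Ta

  _⊑_ : HTView At → HTView At → Set
  𝒲' ⊑ 𝒲 = (∀ Hi Ti → 𝒲 (Hi , Ti) → ∃ λ H'i → 𝒲' (H'i , Ti) × H'i ⊆I Hi)
         × (∀ H'i Ti → 𝒲' (H'i , Ti) → ∃ λ Hi → 𝒲 (Hi , Ti) × H'i ⊆I Hi)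

  ⊑-refl : {𝒲 : HTView At} → 𝒲 ⊑ 𝒲
  ⊑-refl = (λ Hi _ w → Hi , w , ⊆I-refl) , (λ Hi _ w → Hi , w , ⊆I-refl)

  SatisfiesAt : Theory At → HTView At → Interp At → Interp At → Set
  SatisfiesAt Γ 𝒲 H T = ∀ φ → Γ φ → fsat 𝒲 H T φ

  HTSatisfies : (PForm At → Set) → Interp At → Interp At → Set
  HTSatisfies Δ H T = ∀ φ → Δ φ → htsat H T φ

  tot-cong : {𝒲 𝒲' : HTView At} → 𝒲 ≐ 𝒲' → tot 𝒲 ≐ tot 𝒲'
  tot-cong 𝒲≐𝒲' (_ , T) =
    (λ { (H≡T , H₀ , w) → H≡T , H₀ , proj₁ (𝒲≐𝒲' (H₀ , T)) w })
    , (λ { (H≡T , H₀ , w) → H≡T , H₀ , proj₂ (𝒲≐𝒲' (H₀ , T)) w })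

  fsat-cong : {𝒲 𝒲' : HTView At} → 𝒲 ≐ 𝒲' → ∀ H T φ → fsat 𝒲 H T φ ⇔ fsat 𝒲' H T φ
  fsat-cong e H T ⊥'       = ⇔-id _
  fsat-cong e H T (atom a) = ⇔-id _
  fsat-cong e H T (φ ∧' ψ) = fsat-cong e H T φ ×-⇔ fsat-cong e H T ψ
  fsat-cong e H T (φ ∨' ψ) = fsat-cong e H T φ ⊎-⇔ fsat-cong e H T ψ
  fsat-cong e H T (φ ⇒ ψ)  =
    →-cong-⇔ (fsat-cong e H T φ) (fsat-cong e H T ψ)
    ×-⇔ →-cong-⇔ (fsat-cong (tot-cong e) T T φ) (fsat-cong (tot-cong e) T T ψ)
  fsat-cong e H T (L ψ)    = mk⇔
    (λ u Hi Ti w → to (fsat-cong e Hi Ti ψ) (u Hi Ti (proj₂ (e (Hi , Ti)) w)))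
    (λ u Hi Ti w → from (fsat-cong e Hi Ti ψ) (u Hi Ti (proj₁ (e (Hi , Ti)) w)))

  satisfiesAt-cong : {Γ : Theory At} {𝒲 𝒲' : HTView At} {H T : Interp At} →
                     𝒲 ≐ 𝒲' → SatisfiesAt Γ 𝒲 H T → SatisfiesAt Γ 𝒲' H T
  satisfiesAt-cong e sat φ γ = to (fsat-cong e _ _ φ) (sat φ γ)

  tot-totalView : (W : View At) → tot (totalView W) ≐ totalView W
  tot-totalView W (H , T) = (λ { (H≡T , _ , refl , w) → H≡T , w })
                          , (λ { (H≡T , w) → H≡T , T , refl , w })

  fsat-totalView⇔gsat : (W : View At) → ∀ T φ → fsat (totalView W) T T φ ⇔ gsat W T φ
  fsat-totalView⇔gsat W T ⊥'       = ⇔-id _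
  fsat-totalView⇔gsat W T (atom a) = ⇔-id _
  fsat-totalView⇔gsat W T (φ ∧' ψ) = fsat-totalView⇔gsat W T φ ×-⇔ fsat-totalView⇔gsat W T ψ
  fsat-totalView⇔gsat W T (φ ∨' ψ) = fsat-totalView⇔gsat W T φ ⊎-⇔ fsat-totalView⇔gsat W T ψ
  fsat-totalView⇔gsat W T (φ ⇒ ψ)  = mk⇔ (λ (h , _) → to φ⇒ψ h) (λ g → from φ⇒ψ g , from φ⇒ψᵗ g)
    where
    φ⇒ψ : (fsat (totalView W) T T φ → fsat (totalView W) T T ψ) ⇔ (gsat W T φ → gsat W T ψ)
    φ⇒ψ = →-cong-⇔ (fsat-totalView⇔gsat W T φ) (fsat-totalView⇔gsat W T ψ)
    viaTot : ∀ χ → fsat (tot (totalView W)) T T χ ⇔ gsat W T χ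
    viaTot χ = fsat-totalView⇔gsat W T χ ⇔-∘ fsat-cong (tot-totalView W) T T χ
    φ⇒ψᵗ : (fsat (tot (totalView W)) T T φ → fsat (tot (totalView W)) T T ψ)
         ⇔ (gsat W T φ → gsat W T ψ)
    φ⇒ψᵗ = →-cong-⇔ (viaTot φ) (viaTot ψ)
  fsat-totalView⇔gsat W T (L ψ)    = mk⇔
    (λ u J w → to (fsat-totalView⇔gsat W J ψ) (u J J (refl , w)))
    (λ { m J _ (refl , w) → from (fsat-totalView⇔gsat W J ψ) (m J w) })

  htsat-diag⇔csat : (T : Interp At) → ∀ φ → htsat T T φ ⇔ csat T φ
  htsat-diag⇔csat T ⊥p        = ⇔-id _
  htsat-diag⇔csat T (atomp a) = ⇔-id _
  htsat-diag⇔csat T (φ ∧p ψ)  = htsat-diag⇔csat T φ ×-⇔ htsat-diag⇔csat T ψ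
  htsat-diag⇔csat T (φ ∨p ψ)  = htsat-diag⇔csat T φ ⊎-⇔ htsat-diag⇔csat T ψ
  htsat-diag⇔csat T (φ ⇒p ψ)  = mk⇔ proj₁
    (λ c → c , from (→-cong-⇔ (htsat-diag⇔csat T φ) (htsat-diag⇔csat T ψ)) c)

  Red-fsat⇔htsat : (W : View At) → ∀ {φ φ'} → Red W φ φ' →
                   ∀ H T → fsat (totalView W) H T φ ⇔ htsat H T φ'
  Red-fsat⇔htsat W r⊥       H T = ⇔-id _
  Red-fsat⇔htsat W (ratm a) H T = ⇔-id _
  Red-fsat⇔htsat W (r∧ r s) H T = Red-fsat⇔htsat W r H T ×-⇔ Red-fsat⇔htsat W s H T
  Red-fsat⇔htsat W (r∨ r s) H T = Red-fsat⇔htsat W r H T ⊎-⇔ Red-fsat⇔htsat W s H T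
  Red-fsat⇔htsat W (r⇒ {φ} {ψ} {φ'} {ψ'} r s) H T = mk⇔
    (λ (h , t) → to classical t , to here h)
    (λ (c , h) → from here h , from classical c)
    where
    here : (fsat (totalView W) H T φ → fsat (totalView W) H T ψ) ⇔ (htsat H T φ' → htsat H T ψ')
    here = →-cong-⇔ (Red-fsat⇔htsat W r H T) (Red-fsat⇔htsat W s H T)
    atT : ∀ {χ χ'} → Red W χ χ' → fsat (tot (totalView W)) T T χ ⇔ csat T χ'
    atT {χ} {χ'} q = (htsat-diag⇔csat T χ' ⇔-∘ Red-fsat⇔htsat W q T T)
                     ⇔-∘ fsat-cong (tot-totalView W) T T χ
    classical : (fsat (tot (totalView W)) T T φ → fsat (tot (totalView W)) T T ψ)
              ⇔ (csat T φ' → csat T ψ')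
    classical = →-cong-⇔ (atT r) (atT s)
  Red-fsat⇔htsat W (rL⊤ {ψ} m)  H T = mk⇔ (λ _ → (λ ()) , (λ ()))
    (λ _ → λ { J _ (refl , w) → from (fsat-totalView⇔gsat W J ψ) (m J w) })
  Red-fsat⇔htsat W (rL⊥ {ψ} ¬m) H T = mk⇔
    (λ u → ¬m (λ J w → to (fsat-totalView⇔gsat W J ψ) (u J J (refl , w))))
    (λ ())

  Red-exists : ExcludedMiddle 0ℓ → (W : View At) → ∀ φ → ∃ (Red W φ)
  Red-exists em W ⊥'       = _ , r⊥
  Red-exists em W (atom a) = _ , ratm a
  Red-exists em W (φ ∧' ψ) = _ , r∧ (proj₂ (Red-exists em W φ)) (proj₂ (Red-exists em W ψ))
  Red-exists em W (φ ∨' ψ) = _ , r∨ (proj₂ (Red-exists em W φ)) (proj₂ (Red-exists em W ψ))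
  Red-exists em W (φ ⇒ ψ)  = _ , r⇒ (proj₂ (Red-exists em W φ)) (proj₂ (Red-exists em W ψ))
  Red-exists em W (L ψ) with em {ModelsL W ψ}
  ... | yes m = _ , rL⊤ m
  ... | no ¬m = _ , rL⊥ ¬m

  satisfiesAt-totalView⇔reduct : ExcludedMiddle 0ℓ → {Γ : Theory At} {W : View At} {H T : Interp At} →
    SatisfiesAt Γ (totalView W) H T ⇔ HTSatisfies (reduct Γ W) H T
  satisfiesAt-totalView⇔reduct em {Γ} {W} {H} {T} = mk⇔
    (λ sat φ' (φ , γ , r) → to (Red-fsat⇔htsat W r H T) (sat φ γ))
    (λ hsat φ γ → let (φ' , r) = Red-exists em W φ in
                  from (Red-fsat⇔htsat W r H T) (hsat φ' (φ , γ , r)))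

  beliefModel-satisfiesAt : ∀ {Γ 𝒲 H T} → BeliefModel Γ 𝒲 H T → SatisfiesAt Γ 𝒲 H T
  beliefModel-satisfiesAt (_ , _ , sat) φ γ = proj₁ (sat φ γ)

  beliefModel-move : ∀ {Γ 𝒲 H T H' T'} → BeliefModel Γ 𝒲 H T →
                     H' ⊆I T' → SatisfiesAt Γ 𝒲 H' T' → BeliefModel Γ 𝒲 H' T'
  beliefModel-move (isView , _ , sat) H'⊆T' sat' =
    isView , H'⊆T' , λ φ γ → sat' φ γ , proj₂ (sat φ γ)

  beliefModel-member : ∀ {Γ 𝒲 H T Hi Ti} → BeliefModel Γ 𝒲 H T →
                       𝒲 (Hi , Ti) → BeliefModel Γ 𝒲 Hi Ti
  beliefModel-member {Hi = Hi} {Ti} bm@((_ , pairs⊆) , _ , sat) w =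
    beliefModel-move bm (pairs⊆ Hi Ti w) (λ φ γ → proj₂ (sat φ γ) Hi Ti w)

  EQB-view-minimal : ∀ {Γ W T 𝒲' H' T'} → W T → EQB Γ W T →
    BeliefModel Γ 𝒲' H' T' → 𝒲' ⊑ totalView W → ¬ ¬ (𝒲' ≐ totalView W)
  EQB-view-minimal {T = T} wT (_ , minimal) bm' 𝒲'⊑W 𝒲'≉W =
    let (H₀ , w₀ , H₀⊆T) = proj₁ 𝒲'⊑W T T (refl , wT) in
    minimal _ H₀ T (beliefModel-member bm' w₀)
      ((refl , H₀⊆T , 𝒲'⊑W) , λ (𝒲'≐W , _) → 𝒲'≉W 𝒲'≐W)

  EQB⇒stable : ExcludedMiddle 0ℓ → ∀ {Γ W T} → EQB Γ W T → SM (reduct Γ W) T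
  EQB⇒stable em {Γ} {W} {T} (bm , minimal) = models , stable
    where
    models : ∀ φ' → reduct Γ W φ' → csat T φ'
    models φ' d = to (htsat-diag⇔csat T φ')
      (to (satisfiesAt-totalView⇔reduct em) (beliefModel-satisfiesAt bm) φ' d)
    stable : ∀ H → H ⊂I T → ¬ HTSatisfies (reduct Γ W) H T
    stable H (H⊆T , H≢T) hsat =
      minimal _ H T (beliefModel-move bm H⊆T (from (satisfiesAt-totalView⇔reduct em) hsat))
        ((refl , H⊆T , ⊑-refl) , λ (_ , H≡T , _) → H≢T H≡T)

  stable⇒EQB : ExcludedMiddle 0ℓ → ∀ {Γ W T} → EqWorldView Γ W → SM (reduct Γ W) T → EQB Γ W T
  stable⇒EQB em {Γ} {W} {T} ((T₀ , wT₀) , eqv) (models , stable) = bm , minimal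
    where
    eqb₀ : EQB Γ W T₀
    eqb₀ = proj₁ (eqv T₀) wT₀
    bm : BeliefModel Γ (totalView W) T T
    bm = beliefModel-move (proj₁ eqb₀) ⊆I-refl (from (satisfiesAt-totalView⇔reduct em)
           λ φ' d → from (htsat-diag⇔csat T φ') (models φ' d))
    minimal : ∀ 𝒲' H' T' → BeliefModel Γ 𝒲' H' T' → ¬ Prec 𝒲' H' T' (totalView W) T T
    minimal _ H' _ bm' ((refl , H'⊆T , 𝒲'⊑W) , ≺) =
      EQB-view-minimal wT₀ eqb₀ bm' 𝒲'⊑W λ 𝒲'≐W →
        stable H' (H'⊆T , λ H'≡T → ≺ (𝒲'≐W , H'≡T , refl))
          (to (satisfiesAt-totalView⇔reduct em)
              (satisfiesAt-cong 𝒲'≐W (beliefModel-satisfiesAt bm')))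

theorem3 : (∀ (ℓ : Level) → ExcludedMiddle ℓ) → (∀ (a b : Level) → Extensionality a b) →
    (At : Set) (Γ : Theory At) (W : View At) →
    EqWorldView Γ W → G91WorldView Γ W
theorem3 em _ At Γ W eqw@(_ , eqv) I =
    (λ wI → EQB⇒stable (em 0ℓ) (proj₁ (eqv I) wI))
  , (λ stableI → proj₂ (eqv I) (stable⇒EQB (em 0ℓ) eqw stableI))
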